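{- Let $M$ be a module of a graph $G$ such that $G[M]$ is a clique. Then for every maximum spanning interval subgraph $\underline{G}$ of $G$, the set $M$ is a module of $\underline{G}$ and $\underline{G}[M]$ is a clique.
   Context: Graphs are finite, simple, undirected. A module of $G$ is a set $M\subseteq V(G)$ such that every vertex outside $M$ is adjacent to all or none of $M$. A spanning interval subgraph of $G$ is an interval graph on vertex set $V(G)$ with edge set contained in $E(G)$; it is maximum if it has the maximum number of edges among such. -}

module Defs where

open import Data.Nat using (ℕ; _≤_; _<ᵇ_)
open import Data.Fin using (Fin; toℕ)
open import Data.Fin.Subset using (Subset; _∈_; _∉_)
open import Data.Bool using (Bool; true; false; if_then_else_; _∧_)
open import Data.List using (allFin; map)
open import Data.Nat.ListAction using (sum)
open import Data.Product using (Σ; _×_; ∃)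
open import Data.Sum using (_⊎_)
open import Relation.Binary.PropositionalEquality using (_≡_; _≢_)
open import Relation.Nullary using (¬_)

record Graph (n : ℕ) : Set where
  field
    adj   : Fin n → Fin n → Bool
    sym   : ∀ i j → adj i j ≡ adj j i
    irrefl : ∀ i → adj i i ≡ false
open Graph public

Adj : ∀ {n} → Graph n → Fin n → Fin n → Set
Adj G i j = adj G i j ≡ true

edgeCount : ∀ {n} → Graph n → ℕ
edgeCount {n} G =
  sum (map (λ i → sum (map (λ j → if (toℕ i <ᵇ toℕ j) ∧ adj G i j then 1 else 0)
                           (allFin n)))
           (allFin n))

SpanningSubgraph : ∀ {n} → Graph n → Graph n → Set
SpanningSubgraph H G = ∀ i j → Adj H i j → Adj G i j

Intersect : ℕ → ℕ → ℕ → ℕ → Set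
Intersect l₁ r₁ l₂ r₂ = (l₁ ≤ r₂) × (l₂ ≤ r₁)

IsInterval : ∀ {n} → Graph n → Set
IsInterval {n} H =
  Σ (Fin n → ℕ) λ ℓ → Σ (Fin n → ℕ) λ r →
    (∀ i → ℓ i ≤ r i) ×
    (∀ i j → i ≢ j → (Adj H i j → Intersect (ℓ i) (r i) (ℓ j) (r j))
                   × (Intersect (ℓ i) (r i) (ℓ j) (r j) → Adj H i j))

SpanningIntervalSubgraph : ∀ {n} → Graph n → Graph n → Set
SpanningIntervalSubgraph H G = SpanningSubgraph H G × IsInterval H

MaxSpanningIntervalSubgraph : ∀ {n} → Graph n → Graph n → Set
MaxSpanningIntervalSubgraph H G =
  SpanningIntervalSubgraph H G ×
  (∀ H' → SpanningIntervalSubgraph H' G → edgeCount H' ≤ edgeCount H)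

IsModule : ∀ {n} → Graph n → Subset n → Set
IsModule G M =
  ∀ v → v ∉ M → (∀ x → x ∈ M → Adj G v x) ⊎ (∀ x → x ∈ M → ¬ Adj G v x)

IsCliqueOn : ∀ {n} → Graph n → Subset n → Set
IsCliqueOn G M = ∀ x y → x ∈ M → y ∈ M → x ≢ y → Adj G x y

-- Fix an interval model (ℓ, r) of a maximum spanning interval subgraph H of G.  Moving the
-- interval of one vertex x to some [L, R] all of whose meeting vertices are G-neighbours of x
-- gives another spanning interval subgraph, equal to H away from x; since the edge count changes
-- by the change of deg x, maximality forbids deg x to grow.  If x, m ∈ M were non-adjacent in H,
-- moving x onto the interval of m is such a move (M is a clique module of G) and gives x all of
-- m's neighbours plus m, so deg m < deg x, and symmetrically deg x < deg m.  Once M is a clique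
-- of H, a vertex v ∉ M adjacent to a ∈ M but not to b ∈ M is excluded by moving b onto the hull
-- of the intervals of a and b, which strictly increases the degree of b.

module Submission where

open import Defs hiding (sym; irrefl)
open import Data.Nat using (ℕ; zero; suc; _+_; _≤_; _<_; _<ᵇ_; _⊓_; _⊔_; z≤n)
open import Data.Nat.Properties hiding (_≟_)
open import Data.Nat.Tactic.RingSolver using (solve-∀)
open import Data.Fin using (Fin; toℕ; _≟_; punchIn)
open import Data.Fin.Properties using (toℕ-injective; punchInᵢ≢i; any?)
open import Data.Fin.Subset using (Subset; _∈_; _∉_)
open import Data.Fin.Subset.Properties using (_∈?_)
open import Data.Bool using (Bool; true; false; if_then_else_; _∧_)
open import Data.Bool.Properties using (⇔→≡; T-≡; ¬-not; ∧-zeroʳ) renaming (_≟_ to _≟ᵇ_)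
open import Data.List using (allFin; map; tabulate)
open import Data.List.Properties using (map-tabulate)
open import Data.Nat.ListAction using (sum)
open import Data.Vec.Functional using (updateAt; removeAt)
open import Data.Vec.Functional.Properties using (updateAt-updates; updateAt-minimal)
open import Algebra.Properties.CommutativeMonoid.Sum +-0-commutativeMonoid
  using (sum-remove; sum-cong-≗; ∑-distrib-+) renaming (sum to ∑)
open import Data.Product using (_×_; _,_; proj₁; proj₂)
open import Data.Sum using (_⊎_; inj₁; inj₂)
open import Data.Empty using (⊥-elim)
open import Function using (_∘_; id; mk⇔; Equivalence)
open import Relation.Binary.PropositionalEquality
open import Relation.Nullary using (¬_; Dec; yes; no; does; ¬?)
open import Relation.Nullary.Decidable using (_×-dec_; toWitness; isYes≗does; dec-true; dec-false; decidable-stable)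
open import Relation.Nullary.Reflects using (ofʸ; ofⁿ)

∑-allFin : ∀ {n} (f : Fin n → ℕ) → sum (map f (allFin n)) ≡ ∑ f
∑-allFin f = trans (cong sum (map-tabulate id f)) (sum-tabulate f)
  where
  sum-tabulate : ∀ {n} (f : Fin n → ℕ) → sum (tabulate f) ≡ ∑ f
  sum-tabulate {zero}  f = refl
  sum-tabulate {suc n} f = cong (f Fin.zero +_) (sum-tabulate (f ∘ Fin.suc))

∑-mono-≤ : ∀ {n} {f g : Fin n → ℕ} → (∀ i → f i ≤ g i) → ∑ f ≤ ∑ g
∑-mono-≤ {zero}  f≤g = z≤n
∑-mono-≤ {suc n} f≤g = +-mono-≤ (f≤g Fin.zero) (∑-mono-≤ (f≤g ∘ Fin.suc))

∑-mono-< : ∀ {n} {f g : Fin n → ℕ} → (∀ i → f i ≤ g i) → ∀ y → f y < g y → ∑ f < ∑ g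
∑-mono-< {suc n} {f} {g} f≤g y fy<gy = begin-strict
  ∑ f                       ≡⟨ sum-remove f ⟩
  f y + ∑ (removeAt f y)    <⟨ +-mono-<-≤ fy<gy (∑-mono-≤ (f≤g ∘ punchIn y)) ⟩
  g y + ∑ (removeAt g y)    ≡⟨ sum-remove g ⟨
  ∑ g                       ∎
  where open ≤-Reasoning

∑-update : ∀ {n} (x : Fin n) (f g : Fin n → ℕ) → (∀ j → j ≢ x → f j ≡ g j) →
  ∑ f + g x ≡ ∑ g + f x
∑-update {suc n} x f g f≗g = begin
  ∑ f + g x                          ≡⟨ cong (_+ g x) (sum-remove f) ⟩
  (f x + ∑ (removeAt f x)) + g x     ≡⟨ cong (λ s → (f x + s) + g x) rest ⟩
  (f x + ∑ (removeAt g x)) + g x     ≡⟨ exchange (f x) _ (g x) ⟩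
  (g x + ∑ (removeAt g x)) + f x     ≡⟨ cong (_+ f x) (sum-remove g) ⟨
  ∑ g + f x                          ∎
  where
  open ≡-Reasoning
  rest : ∑ (removeAt f x) ≡ ∑ (removeAt g x)
  rest = sum-cong-≗ (λ j → f≗g (punchIn x j) (punchInᵢ≢i x j))
  exchange : ∀ a s b → (a + s) + b ≡ (b + s) + a
  exchange = solve-∀

∑∑ : ∀ {n} → (Fin n → Fin n → ℕ) → ℕ
∑∑ f = ∑ λ i → ∑ (f i)

cross : ∀ {n} → (Fin n → Fin n → ℕ) → Fin n → ℕ
cross f x = ∑ λ i → f i x + f x i

-- The cross at x counts the diagonal entry twice, whence the correction terms f x x and g x x.
∑∑-update : ∀ {n} (x : Fin n) (f g : Fin n → Fin n → ℕ) →
  (∀ i j → i ≢ x → j ≢ x → f i j ≡ g i j) →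
  ∑∑ f + (cross g x + f x x) ≡ ∑∑ g + (cross f x + g x x)
∑∑-update x f g agree = begin
  ∑∑ f + (cross g x + f x x)                          ≡⟨ regroup f g ⟨
  ∑ (λ i → ∑ (f i) + g i x) + (∑ (g x) + f x x)       ≡⟨ ∑-update x _ _ rows ⟩
  ∑ (λ i → ∑ (g i) + f i x) + (∑ (f x) + g x x)       ≡⟨ regroup g f ⟩
  ∑∑ g + (cross f x + g x x)                          ∎
  where
  open ≡-Reasoning
  rows : ∀ i → i ≢ x → ∑ (f i) + g i x ≡ ∑ (g i) + f i x
  rows i i≢x = ∑-update x (f i) (g i) (λ j j≢x → agree i j i≢x j≢x)
  reassoc : ∀ a b c d → (a + b) + (c + d) ≡ a + ((b + c) + d)
  reassoc = solve-∀
  regroup : ∀ f g →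
    ∑ (λ i → ∑ (f i) + g i x) + (∑ (g x) + f x x) ≡ ∑∑ f + (cross g x + f x x)
  regroup f g = begin
    ∑ (λ i → ∑ (f i) + g i x) + (∑ (g x) + f x x)
      ≡⟨ cong (_+ (∑ (g x) + f x x)) (∑-distrib-+ (λ i → ∑ (f i)) (λ i → g i x)) ⟩
    (∑∑ f + ∑ (λ i → g i x)) + (∑ (g x) + f x x)
      ≡⟨ reassoc (∑∑ f) (∑ (λ i → g i x)) (∑ (g x)) (f x x) ⟩
    ∑∑ f + ((∑ (λ i → g i x) + ∑ (g x)) + f x x)
      ≡⟨ cong (λ c → ∑∑ f + (c + f x x)) (∑-distrib-+ (λ i → g i x) (g x)) ⟨
    ∑∑ f + (cross g x + f x x)
      ∎

Adj-sym : ∀ {n} (G : Graph n) {i j} → Adj G i j → Adj G j i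
Adj-sym G {i} {j} e = trans (Graph.sym G j i) e

Adj-irrefl : ∀ {n} (G : Graph n) {i} → ¬ Adj G i i
Adj-irrefl G {i} e with () ← trans (sym (Graph.irrefl G i)) e

Adj⇒≢ : ∀ {n} (G : Graph n) {i j} → Adj G i j → i ≢ j
Adj⇒≢ G e refl = Adj-irrefl G e

indicator : Bool → ℕ
indicator b = if b then 1 else 0

indicator-mono : ∀ {a b} → (a ≡ true → b ≡ true) → indicator a ≤ indicator b
indicator-mono {false} a⇒b = z≤n
indicator-mono {true}  a⇒b rewrite a⇒b refl = ≤-refl

deg : ∀ {n} → Graph n → Fin n → ℕ
deg G x = ∑ λ j → indicator (adj G x j)

deg-< : ∀ {n} (G : Graph n) y (G' : Graph n) x w →
  (∀ j → Adj G y j → Adj G' x j) → ¬ Adj G y w → Adj G' x w → deg G y < deg G' x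
deg-< G y G' x w N⊆N' ¬yw xw =
  ∑-mono-< (λ j → indicator-mono (N⊆N' j)) w
    (subst₂ (λ a b → indicator a < indicator b) (sym (¬-not ¬yw)) (sym xw) ≤-refl)

AgreeOff : ∀ {n} → Fin n → Graph n → Graph n → Set
AgreeOff x H H' = ∀ i j → i ≢ x → j ≢ x → adj H i j ≡ adj H' i j

edgeIndicator : ∀ {n} → Graph n → Fin n → Fin n → ℕ
edgeIndicator G i j = indicator ((toℕ i <ᵇ toℕ j) ∧ adj G i j)

edgeCount≡∑∑ : ∀ {n} (G : Graph n) → edgeCount G ≡ ∑∑ (edgeIndicator G)
edgeCount≡∑∑ G =
  trans (∑-allFin (λ i → sum (map (edgeIndicator G i) (allFin _))))
        (sum-cong-≗ λ i → ∑-allFin (edgeIndicator G i))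

edgeIndicator-diag : ∀ {n} (G : Graph n) x → edgeIndicator G x x ≡ 0
edgeIndicator-diag G x =
  cong indicator (trans (cong ((toℕ x <ᵇ toℕ x) ∧_) (Graph.irrefl G x)) (∧-zeroʳ _))

edgeIndicator-pair : ∀ {n} (G : Graph n) x j →
  edgeIndicator G j x + edgeIndicator G x j ≡ indicator (adj G x j)
edgeIndicator-pair G x j
  with toℕ j <ᵇ toℕ x | <ᵇ-reflects-< (toℕ j) (toℕ x)
     | toℕ x <ᵇ toℕ j | <ᵇ-reflects-< (toℕ x) (toℕ j)
... | true  | ofʸ j<x | true  | ofʸ x<j = ⊥-elim (<-asym j<x x<j)
... | true  | _       | false | _       = trans (+-identityʳ _) (cong indicator (Graph.sym G j x))
... | false | _       | true  | _       = refl
... | false | ofⁿ j≮x | false | ofⁿ x≮j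
      rewrite toℕ-injective (≤-antisym (≮⇒≥ x≮j) (≮⇒≥ j≮x)) | Graph.irrefl G x = refl

cross-edgeIndicator : ∀ {n} (G : Graph n) x → cross (edgeIndicator G) x ≡ deg G x
cross-edgeIndicator G x = sum-cong-≗ (edgeIndicator-pair G x)

edgeCount-update : ∀ {n} (H H' : Graph n) x → AgreeOff x H H' →
  edgeCount H + deg H' x ≡ edgeCount H' + deg H x
edgeCount-update H H' x agree = begin
  edgeCount H + deg H' x
    ≡⟨ cong₂ _+_ (edgeCount≡∑∑ H) (sym (degree H H')) ⟩
  ∑∑ (edgeIndicator H) + (cross (edgeIndicator H') x + edgeIndicator H x x)
    ≡⟨ ∑∑-update x (edgeIndicator H) (edgeIndicator H') agree′ ⟩
  ∑∑ (edgeIndicator H') + (cross (edgeIndicator H) x + edgeIndicator H' x x)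
    ≡⟨ cong₂ _+_ (sym (edgeCount≡∑∑ H')) (degree H' H) ⟩
  edgeCount H' + deg H x ∎
  where
  open ≡-Reasoning
  agree′ : ∀ i j → i ≢ x → j ≢ x → edgeIndicator H i j ≡ edgeIndicator H' i j
  agree′ i j i≢x j≢x = cong (λ b → indicator ((toℕ i <ᵇ toℕ j) ∧ b)) (agree i j i≢x j≢x)
  degree : ∀ G G' → cross (edgeIndicator G') x + edgeIndicator G x x ≡ deg G' x
  degree G G' = begin
    cross (edgeIndicator G') x + edgeIndicator G x x ≡⟨ cong (_ +_) (edgeIndicator-diag G x) ⟩
    cross (edgeIndicator G') x + 0                   ≡⟨ +-identityʳ _ ⟩
    cross (edgeIndicator G') x                       ≡⟨ cross-edgeIndicator G' x ⟩
    deg G' x                                         ∎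

maximum⇒deg-≤ : ∀ {n} {G H H' : Graph n} x → MaxSpanningIntervalSubgraph H G →
  SpanningIntervalSubgraph H' G → AgreeOff x H H' → deg H' x ≤ deg H x
maximum⇒deg-≤ {H = H} {H'} x (_ , maximum) H'-ok agree =
  +-cancelˡ-≤ (edgeCount H) _ _ (begin
    edgeCount H + deg H' x   ≡⟨ edgeCount-update H H' x agree ⟩
    edgeCount H' + deg H x   ≤⟨ +-monoˡ-≤ (deg H x) (maximum H' H'-ok) ⟩
    edgeCount H + deg H x    ∎)
  where open ≤-Reasoning

Intersect-sym : ∀ {l r l' r'} → Intersect l r l' r' → Intersect l' r' l r
Intersect-sym (l≤r' , l'≤r) = l'≤r , l≤r'

Intersect-cong : ∀ {a a' b b' c c' d d'} → a ≡ a' → b ≡ b' → c ≡ c' → d ≡ d' →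
  Intersect a b c d → Intersect a' b' c' d'
Intersect-cong refl refl refl refl I = I

Intersect-widen : ∀ {L R l r l' r'} → L ≤ l → r ≤ R → Intersect l r l' r' → Intersect L R l' r'
Intersect-widen L≤l r≤R (l≤r' , l'≤r) = ≤-trans L≤l l≤r' , ≤-trans l'≤r r≤R

-- The hull of two intersecting intervals is their union.
Intersect-hull : ∀ {la ra lb rb l r} → Intersect la ra lb rb → l ≤ r →
  Intersect (la ⊓ lb) (ra ⊔ rb) l r → Intersect la ra l r ⊎ Intersect lb rb l r
Intersect-hull {la} {ra} {lb} {rb} {l} {r} (la≤rb , lb≤ra) l≤r (la⊓lb≤r , l≤ra⊔rb)
  with l ≤? ra | la ≤? r
... | yes l≤ra | yes la≤r = inj₁ (la≤r , l≤ra)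
... | yes l≤ra | no la≰r  = inj₂ (lb≤r , ≤-trans l≤r (≤-trans (<⇒≤ (≰⇒> la≰r)) la≤rb))
  where
  lb≤r : lb ≤ r
  lb≤r with ⊓-sel la lb
  ... | inj₁ la⊓lb≡la = ⊥-elim (la≰r (subst (_≤ r) la⊓lb≡la la⊓lb≤r))
  ... | inj₂ la⊓lb≡lb = subst (_≤ r) la⊓lb≡lb la⊓lb≤r
... | no l≰ra  | _        = inj₂ (≤-trans lb≤ra (≤-trans (<⇒≤ (≰⇒> l≰ra)) l≤r) , l≤rb)
  where
  l≤rb : l ≤ rb
  l≤rb with ⊔-sel ra rb
  ... | inj₁ ra⊔rb≡ra = ⊥-elim (l≰ra (subst (l ≤_) ra⊔rb≡ra l≤ra⊔rb))
  ... | inj₂ ra⊔rb≡rb = subst (l ≤_) ra⊔rb≡rb l≤ra⊔rb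

Models : ∀ {n} → Graph n → (Fin n → ℕ) → (Fin n → ℕ) → Set
Models H ℓ r = ∀ i j → i ≢ j → (Adj H i j → Intersect (ℓ i) (r i) (ℓ j) (r j))
                           × (Intersect (ℓ i) (r i) (ℓ j) (r j) → Adj H i j)

adj-determined : ∀ {n} {H H' : Graph n} {ℓ r ℓ' r'} → Models H ℓ r → Models H' ℓ' r' →
  ∀ {i j} → ℓ i ≡ ℓ' i → r i ≡ r' i → ℓ j ≡ ℓ' j → r j ≡ r' j → adj H i j ≡ adj H' i j
adj-determined {H = H} {H'} model model' {i} {j} ℓᵢ rᵢ ℓⱼ rⱼ with i ≟ j
... | yes refl = trans (Graph.irrefl H i) (sym (Graph.irrefl H' i))
... | no i≢j = ⇔→≡ (mk⇔
  (λ e → proj₂ (model' i j i≢j) (Intersect-cong ℓᵢ rᵢ ℓⱼ rⱼ (proj₁ (model i j i≢j) e)))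
  (λ e → proj₂ (model i j i≢j)
           (Intersect-cong (sym ℓᵢ) (sym rᵢ) (sym ℓⱼ) (sym rⱼ) (proj₁ (model' i j i≢j) e))))

module _ {n} (ℓ r : Fin n → ℕ) where

  intersects? : ∀ i j → Dec (i ≢ j × Intersect (ℓ i) (r i) (ℓ j) (r j))
  intersects? i j = ¬? (i ≟ j) ×-dec ((ℓ i ≤? r j) ×-dec (ℓ j ≤? r i))

  intersects?-sound : ∀ i j → does (intersects? i j) ≡ true →
    i ≢ j × Intersect (ℓ i) (r i) (ℓ j) (r j)
  intersects?-sound i j e =
    toWitness {a? = intersects? i j} (Equivalence.from T-≡ (trans (isYes≗does (intersects? i j)) e))

  intersects?-sym : ∀ i j → does (intersects? i j) ≡ true → does (intersects? j i) ≡ true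
  intersects?-sym i j e =
    let (i≢j , I) = intersects?-sound i j e in dec-true (intersects? j i) (≢-sym i≢j , Intersect-sym I)

  intervalGraph : Graph n
  intervalGraph = record
    { adj    = λ i j → does (intersects? i j)
    ; sym    = λ i j → ⇔→≡ (mk⇔ (intersects?-sym i j) (intersects?-sym j i))
    ; irrefl = λ i → dec-false (intersects? i i) λ (i≢i , _) → i≢i refl
    }

  intervalGraph-models : Models intervalGraph ℓ r
  intervalGraph-models i j i≢j =
    proj₂ ∘ intersects?-sound i j , λ I → dec-true (intersects? i j) (i≢j , I)

neighbour-transfer : ∀ {n} (G : Graph n) {M : Subset n} → IsModule G M → IsCliqueOn G M →
  ∀ {a b j} → a ∈ M → b ∈ M → j ≢ b → Adj G a j → Adj G b j
neighbour-transfer G {M} modG clqG {a} {b} {j} a∈M b∈M j≢b aj with j ∈? M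
... | yes j∈M = clqG b j b∈M j∈M (≢-sym j≢b)
... | no j∉M with modG j j∉M
...   | inj₁ j~M = Adj-sym G (j~M b b∈M)
...   | inj₂ j≁M = ⊥-elim (j≁M a a∈M (Adj-sym G aj))

module MaximumIntervalSubgraph {n} {G H : Graph n} (H⊆G : SpanningSubgraph H G)
  (ℓ r : Fin n → ℕ) (ℓ≤r : ∀ i → ℓ i ≤ r i) (model : Models H ℓ r)
  (maximum : ∀ H' → SpanningIntervalSubgraph H' G → edgeCount H' ≤ edgeCount H) where

  meets : ∀ {i j} → Adj H i j → Intersect (ℓ i) (r i) (ℓ j) (r j)
  meets {i} {j} e = proj₁ (model i j (Adj⇒≢ H e)) e

  adjacent : ∀ {i j} → i ≢ j → Intersect (ℓ i) (r i) (ℓ j) (r j) → Adj H i j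
  adjacent {i} {j} i≢j = proj₂ (model i j i≢j)

  module _ (x : Fin n) (L R : ℕ) where

    ℓ′ r′ : Fin n → ℕ
    ℓ′ = updateAt ℓ x (λ _ → L)
    r′ = updateAt r x (λ _ → R)

    relocated : Graph n
    relocated = intervalGraph ℓ′ r′

    relocated-agrees : AgreeOff x H relocated
    relocated-agrees i j i≢x j≢x =
      adj-determined {H = H} {relocated} {ℓ} {r} {ℓ′} {r′} model (intervalGraph-models ℓ′ r′)
      (unchanged ℓ i≢x) (unchanged r i≢x) (unchanged ℓ j≢x) (unchanged r j≢x)
      where
      unchanged : ∀ (f : Fin n → ℕ) {v c} → v ≢ x → f v ≡ updateAt f x (λ _ → c) v
      unchanged f v≢x = sym (updateAt-minimal _ x f v≢x)

    relocated-adj⁺ : ∀ {j} → j ≢ x → Intersect L R (ℓ j) (r j) → Adj relocated x j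
    relocated-adj⁺ {j} j≢x I = proj₂ (intervalGraph-models ℓ′ r′ x j (≢-sym j≢x))
      (Intersect-cong (sym (updateAt-updates x ℓ)) (sym (updateAt-updates x r))
                      (sym (updateAt-minimal j x ℓ j≢x)) (sym (updateAt-minimal j x r j≢x)) I)

    relocated-adj⁻ : ∀ {j} → Adj relocated x j → j ≢ x × Intersect L R (ℓ j) (r j)
    relocated-adj⁻ {j} e = j≢x , Intersect-cong (updateAt-updates x ℓ) (updateAt-updates x r)
      (updateAt-minimal j x ℓ j≢x) (updateAt-minimal j x r j≢x)
      (proj₁ (intervalGraph-models ℓ′ r′ x j (≢-sym j≢x)) e)
      where
      j≢x : j ≢ x
      j≢x = ≢-sym (Adj⇒≢ relocated e)

    Admissible : Set
    Admissible = ∀ j → j ≢ x → Intersect L R (ℓ j) (r j) → Adj G x j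

    relocated⊆G : Admissible → SpanningSubgraph relocated G
    relocated⊆G admissible i j e with i ≟ x | j ≟ x
    ... | yes refl | _        = let (j≢x , I) = relocated-adj⁻ e in admissible j j≢x I
    ... | no i≢x   | yes refl =
      let (i≢x , I) = relocated-adj⁻ (Adj-sym relocated {i} e) in Adj-sym G (admissible i i≢x I)
    ... | no i≢x   | no j≢x   = H⊆G i j (trans (relocated-agrees i j i≢x j≢x) e)

    relocated-isInterval : L ≤ R → IsInterval relocated
    relocated-isInterval L≤R = ℓ′ , r′ , ℓ′≤r′ , intervalGraph-models ℓ′ r′
      where
      ℓ′≤r′ : ∀ i → ℓ′ i ≤ r′ i
      ℓ′≤r′ i with i ≟ x
      ... | yes refl = subst₂ _≤_ (sym (updateAt-updates x ℓ)) (sym (updateAt-updates x r)) L≤R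
      ... | no i≢x   =
        subst₂ _≤_ (sym (updateAt-minimal i x ℓ i≢x)) (sym (updateAt-minimal i x r i≢x)) (ℓ≤r i)

    relocated-deg-≤ : L ≤ R → Admissible → deg relocated x ≤ deg H x
    relocated-deg-≤ L≤R admissible =
      maximum⇒deg-≤ {G = G} {H} {relocated} x ((H⊆G , ℓ , r , ℓ≤r , model) , maximum)
        (relocated⊆G admissible , relocated-isInterval L≤R) relocated-agrees

  module _ {M : Subset n} (modG : IsModule G M) (clqG : IsCliqueOn G M) where

    -- Moving x onto the interval of m gives x all of m's neighbours and m itself.
    non-adjacent⇒deg-< : ∀ {x m} → x ∈ M → m ∈ M → x ≢ m → ¬ Adj H x m → deg H m < deg H x
    non-adjacent⇒deg-< {x} {m} x∈M m∈M x≢m ¬xm = begin-strict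
      deg H m
        <⟨ deg-< H m (relocated x L R) x m grows (Adj-irrefl H)
                 (relocated-adj⁺ x L R m≢x (ℓ≤r m , ℓ≤r m)) ⟩
      deg (relocated x L R) x
        ≤⟨ relocated-deg-≤ x L R (ℓ≤r m) admissible ⟩
      deg H x
        ∎
      where
      open ≤-Reasoning
      L R : ℕ
      L = ℓ m
      R = r m
      m≢x : m ≢ x
      m≢x = ≢-sym x≢m
      admissible : Admissible x L R
      admissible j j≢x I with j ≟ m
      ... | yes refl = clqG x j x∈M m∈M x≢m
      ... | no j≢m   =
        neighbour-transfer G modG clqG m∈M x∈M j≢x (H⊆G m j (adjacent (≢-sym j≢m) I))
      grows : ∀ j → Adj H m j → Adj (relocated x L R) x j
      grows j mj = relocated-adj⁺ x L R j≢x (meets mj)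
        where
        j≢x : j ≢ x
        j≢x refl = ¬xm (Adj-sym H mj)

    isClique : IsCliqueOn H M
    isClique x y x∈M y∈M x≢y = decidable-stable (adj H x y ≟ᵇ true) λ ¬xy →
      <-asym (non-adjacent⇒deg-< x∈M y∈M x≢y ¬xy)
             (non-adjacent⇒deg-< y∈M x∈M (≢-sym x≢y) (¬xy ∘ Adj-sym H))

    -- Moving b onto the hull of the intervals of a and b keeps its neighbours and gains v.
    split-neighbourhood : ∀ {v a b} → v ∉ M → a ∈ M → b ∈ M → Adj H v a → ¬ ¬ Adj H v b
    split-neighbourhood {v} {a} {b} v∉M a∈M b∈M va ¬vb = <-irrefl refl (begin-strict
      deg H b
        <⟨ deg-< H b (relocated b L R) b v grows (¬vb ∘ Adj-sym H)
                 (relocated-adj⁺ b L R v≢b (around-a (meets (Adj-sym H va)))) ⟩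
      deg (relocated b L R) b
        ≤⟨ relocated-deg-≤ b L R L≤R admissible ⟩
      deg H b
        ∎)
      where
      open ≤-Reasoning
      L R : ℕ
      L = ℓ a ⊓ ℓ b
      R = r a ⊔ r b
      L≤R : L ≤ R
      L≤R = ≤-trans (m⊓n≤m _ _) (≤-trans (ℓ≤r a) (m≤m⊔n _ _))
      a≢b : a ≢ b
      a≢b refl = ¬vb va
      v≢b : v ≢ b
      v≢b refl = v∉M b∈M
      around-a : ∀ {l' r'} → Intersect (ℓ a) (r a) l' r' → Intersect L R l' r'
      around-a = Intersect-widen (m⊓n≤m _ _) (m≤m⊔n _ _)
      around-b : ∀ {l' r'} → Intersect (ℓ b) (r b) l' r' → Intersect L R l' r'
      around-b = Intersect-widen (m⊓n≤n _ _) (m≤n⊔m _ _)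
      admissible : Admissible b L R
      admissible j j≢b I with Intersect-hull (meets (isClique a b a∈M b∈M a≢b)) (ℓ≤r j) I
      ... | inj₂ bj = H⊆G b j (adjacent (≢-sym j≢b) bj)
      ... | inj₁ aj with j ≟ a
      ...   | yes refl = clqG b j b∈M a∈M (≢-sym a≢b)
      ...   | no j≢a   =
        neighbour-transfer G modG clqG a∈M b∈M j≢b (H⊆G a j (adjacent (≢-sym j≢a) aj))
      grows : ∀ j → Adj H b j → Adj (relocated b L R) b j
      grows j bj = relocated-adj⁺ b L R (≢-sym (Adj⇒≢ H bj)) (around-b (meets bj))

    isModule : IsModule H M
    isModule v v∉M with any? (λ a → (a ∈? M) ×-dec (adj H v a ≟ᵇ true))
    ... | yes (a , a∈M , va) = inj₁ λ b b∈M →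
      decidable-stable (adj H v b ≟ᵇ true) (split-neighbourhood v∉M a∈M b∈M va)
    ... | no ¬∃ = inj₂ λ a a∈M va → ¬∃ (a , a∈M , va)

lemma3p2 : ∀ {n} (G : Graph n) (M : Subset n) →
    IsModule G M → IsCliqueOn G M →
    ∀ (H : Graph n) → MaxSpanningIntervalSubgraph H G →
    IsModule H M × IsCliqueOn H M
lemma3p2 G M modG clqG H ((H⊆G , ℓ , r , ℓ≤r , model) , maximum) =
  isModule modG clqG , isClique modG clqG
  where open MaximumIntervalSubgraph {G = G} {H} H⊆G ℓ r ℓ≤r model maximum
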